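{- Let $\circledast$ be a proper multiplication on $\mathbb{Z}^d$ and $A\subseteq\mathbb{Z}^d_{\neq0}$. Then \[d^*_\circledast(A)=\sup\{\alpha\ge0:\ \text{for every finite }F\subseteq\mathbb{Z}^d_{\neq0}\text{ there exist infinitely many }z\in\mathbb{Z}^d_{\neq0}\text{ with }|(F\circledast z)\cap A|\ge\alpha|F|\}.\] In particular, $d^*_\circledast(A)=0$ if and only if for every $\epsilon>0$ there exist a finite $F\subseteq\mathbb{Z}^d_{\neq0}$ and a cofinite $P\subseteq\mathbb{Z}^d_{\neq0}$ such that $|(F\circledast z)\cap A|<\epsilon|F|$ for all $z\in P$.
   Context: A proper multiplication on $\mathbb{Z}^d$ is a binary operation $\circledast$ making $(\mathbb{Z}^d,+)$ an associative (not necessarily commutative or unital) ring without zero divisors; $\mathbb{Z}^d_{\neq0}=\mathbb{Z}^d\setminus\{0\}$; $F\circledast z=\{f\circledast z:f\in F\}$. The density is $d^*_\circledast(A)=\sup\{\alpha\ge0:\ \text{for every finite }F\subseteq\mathbb{Z}^d_{\neq0}\text{ there is }s\in\mathbb{Z}^d_{\neq0}\text{ with }|(F\circledast s)\cap A|\ge\alpha|F|\}$. -}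

module Defs where

open import Level using (0ℓ)
open import Data.Nat as ℕ using (ℕ)
open import Data.Integer as ℤ using (ℤ; +_)
open import Data.Vec using (Vec; replicate; zipWith)
open import Data.Vec.Properties using (≡-dec)
open import Data.List using (List; length; map; filterᵇ; deduplicate)
open import Data.List.Membership.Propositional using (_∉_)
open import Data.List.Relation.Unary.All using (All)
open import Data.List.Relation.Unary.Unique.Propositional using (Unique)
open import Data.Rational as ℚ using (ℚ; _/_; 0ℚ)
open import Data.Bool using (Bool)
open import Data.Product using (Σ; _×_; ∃)
open import Data.Sum using (_⊎_)
open import Relation.Binary.PropositionalEquality using (_≡_; _≢_)
open import Relation.Nullary using (Dec)
open import Data.Empty using (⊥)

ℤ^ : ℕ → Set
ℤ^ d = Vec ℤ d

0v : ∀ {d} → ℤ^ d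
0v {d} = replicate d (+ 0)

_+v_ : ∀ {d} → ℤ^ d → ℤ^ d → ℤ^ d
_+v_ = zipWith ℤ._+_

_≟v_ : ∀ {d} (x y : ℤ^ d) → Dec (x ≡ y)
_≟v_ = ≡-dec ℤ._≟_

record ProperMultiplication (d : ℕ) : Set where
  field
    _⊛_      : ℤ^ d → ℤ^ d → ℤ^ d
    assoc    : ∀ x y z → (x ⊛ y) ⊛ z ≡ x ⊛ (y ⊛ z)
    distribˡ : ∀ x y z → x ⊛ (y +v z) ≡ (x ⊛ y) +v (x ⊛ z)
    distribʳ : ∀ x y z → (y +v z) ⊛ x ≡ (y ⊛ x) +v (z ⊛ x)
    noZeroDivisors : ∀ x y → x ⊛ y ≡ 0v → x ≡ 0v ⊎ y ≡ 0v

record FiniteNonzeroSet (d : ℕ) : Set where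
  field
    elems    : List (ℤ^ d)
    unique   : Unique elems
    nonzero  : All (λ x → x ≢ 0v) elems

open FiniteNonzeroSet public

card : ∀ {d} → FiniteNonzeroSet d → ℚ
card F = + length (elems F) / 1

Subset : ℕ → Set
Subset d = ℤ^ d → Bool

countIn : ∀ {d} → ProperMultiplication d → Subset d → FiniteNonzeroSet d → ℤ^ d → ℚ
countIn M A F z =
  + length (filterᵇ A (deduplicate _≟v_ (map (λ f → f ⊛ z) (elems F)))) / 1
  where open ProperMultiplication M

-- The defining property of the density d*: for every finite F ⊆ ℤ^d_{≠0}
-- there is s ∈ ℤ^d_{≠0} with |(F ⊛ s) ∩ A| ≥ α|F|.
DensityProp : ∀ {d} → ProperMultiplication d → Subset d → ℚ → Set
DensityProp {d} M A α =
  (F : FiniteNonzeroSet d) → ∃ λ s → s ≢ 0v × (α ℚ.* card F ℚ.≤ countIn M A F s)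

-- The same with "there exist infinitely many z ∈ ℤ^d_{≠0}": for every finite
-- list G there is such a z outside G.
InfDensityProp : ∀ {d} → ProperMultiplication d → Subset d → ℚ → Set
InfDensityProp {d} M A α =
  (F : FiniteNonzeroSet d) → (G : List (ℤ^ d)) →
    ∃ λ z → z ≢ 0v × z ∉ G × (α ℚ.* card F ℚ.≤ countIn M A F z)

-- "q < sup {α ≥ 0 : P α}" (α ranging over ℚ; the sets considered are
-- downward closed in [0,∞), so the real supremum is determined by these cuts).
BelowSup : (ℚ → Set) → ℚ → Set
BelowSup P q = ∃ λ α → 0ℚ ℚ.≤ α × q ℚ.< α × P α

-- Equality of two such suprema: equality of their strict lower cuts over ℚ.
SupEq : (ℚ → Set) → (ℚ → Set) → Set
SupEq P Q = (q : ℚ) → (BelowSup P q → BelowSup Q q) × (BelowSup Q q → BelowSup P q)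

-- d*_⊛(A) = 0 : no α > 0 belongs to the defining set.
DensityZero : ∀ {d} → ProperMultiplication d → Subset d → Set
DensityZero M A = (α : ℚ) → 0ℚ ℚ.< α → DensityProp M A α → ⊥

-- for every ε > 0 there exist finite F ⊆ ℤ^d_{≠0} and cofinite P ⊆ ℤ^d_{≠0}
-- (P = ℤ^d_{≠0} \ G, G finite) with |(F ⊛ z) ∩ A| < ε|F| for all z ∈ P.
SmallOnCofinite : ∀ {d} → ProperMultiplication d → Subset d → Set
SmallOnCofinite {d} M A =
  (ε : ℚ) → 0ℚ ℚ.< ε →
    Σ (FiniteNonzeroSet d) λ F → Σ (List (ℤ^ d)) λ G →
      (z : ℤ^ d) → z ≢ 0v → z ∉ G → countIn M A F z ℚ.< ε ℚ.* card F

-- The supremum over "some s" can only be larger than the one over "infinitely many z", so the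
-- content is the converse: if every finite F has one good multiplier, it has arbitrarily large
-- ones. Given F and a finite set G to avoid, take any nonzero x, put h = k·x with k exceeding
-- every ℓ¹-norm in G, and take s good for F ⊛ h. Then z = h ⊛ s is good for F, by
-- associativity and injectivity of · ⊛ h, and z = k·(x ⊛ s) has norm at least k, so z ∉ G.
-- The zero-density criterion is the contrapositive of the "infinitely many" description, read
-- classically.
module Submission where

open import Defs
open import Level using (0ℓ)
open import Data.Nat using (ℕ)
open import Data.Product using (_×_)
open import Axiom.ExcludedMiddle using (ExcludedMiddle)
open import Function.Bundles using (_⇔_)
open import Data.Bool using (true)
open import Relation.Binary.PropositionalEquality using (_≡_; _≢_)

open import Axiom.DoubleNegationElimination using (DoubleNegationElimination; em⇒dne)
open import Data.Empty using (⊥-elim)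
open import Data.Integer as ℤ using (+_)
import Data.Integer.Properties as ℤ
open import Data.List as List using (List; []; _∷_)
import Data.List.Properties as List
open import Data.List.Membership.Propositional using (_∈_; _∉_)
open import Data.List.Relation.Unary.All as All using ()
import Data.List.Relation.Unary.All.Properties as All
open import Data.List.Relation.Unary.Any using (here; there)
import Data.List.Relation.Unary.Unique.Propositional.Properties as Unique
open import Data.Nat as ℕ using (suc; _≤_; _<_; s≤s; z≤n)
import Data.Nat.Properties as ℕ
open import Data.Nat.ListAction using (sum)
open import Data.Product using (Σ; _,_)
import Data.Rational as ℚ
import Data.Rational.Properties as ℚ
open import Data.Sum using (inj₁; inj₂)
open import Data.Vec as Vec using ([]; _∷_)
import Data.Vec.Properties as Vec
open import Function using (_∘_)
open import Function.Bundles using (mk⇔)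
open import Relation.Binary.PropositionalEquality using (refl; sym; trans; cong; cong₂; subst; subst₂; module ≡-Reasoning)

open ≡-Reasoning

module _ {d : ℕ} where

  infix 30 -v_
  -v_ : ℤ^ d → ℤ^ d
  -v_ = Vec.map (λ a → ℤ.- a)

  +v-assoc : ∀ (x y z : ℤ^ d) → (x +v y) +v z ≡ x +v (y +v z)
  +v-assoc = Vec.zipWith-assoc ℤ.+-assoc

  +v-identityˡ : ∀ (x : ℤ^ d) → 0v +v x ≡ x
  +v-identityˡ = Vec.zipWith-identityˡ {f = ℤ._+_} ℤ.+-identityˡ

  +v-identityʳ : ∀ (x : ℤ^ d) → x +v 0v ≡ x
  +v-identityʳ = Vec.zipWith-identityʳ {f = ℤ._+_} ℤ.+-identityʳ

  +v-cancelʳ : ∀ (x y z : ℤ^ d) → x +v z ≡ y +v z → x ≡ y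
  +v-cancelʳ x y z eq = trans (sym (undo x)) (trans (cong (_+v -v z) eq) (undo y))
    where
    undo : ∀ w → (w +v z) +v -v z ≡ w
    undo w = begin
      (w +v z) +v -v z  ≡⟨ +v-assoc w z (-v z) ⟩
      w +v (z +v -v z)  ≡⟨ cong (w +v_) (Vec.zipWith-inverseʳ ℤ.+-inverseʳ z) ⟩
      w +v 0v           ≡⟨ +v-identityʳ w ⟩
      w                 ∎

  -v-+v-cancel : ∀ (x y : ℤ^ d) → (x +v -v y) +v y ≡ x
  -v-+v-cancel x y = begin
    (x +v -v y) +v y  ≡⟨ +v-assoc x (-v y) y ⟩
    x +v (-v y +v y)  ≡⟨ cong (x +v_) (Vec.zipWith-inverseˡ ℤ.+-inverseˡ y) ⟩
    x +v 0v           ≡⟨ +v-identityʳ x ⟩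
    x                 ∎

_·v_ : ∀ {d} → ℕ → ℤ^ d → ℤ^ d
n ·v x = Vec.map (+ n ℤ.*_) x

·v-zero : ∀ {d} (x : ℤ^ d) → 0 ·v x ≡ 0v
·v-zero []      = refl
·v-zero (a ∷ x) = cong (+ 0 ∷_) (·v-zero x)

·v-suc : ∀ {d} n (x : ℤ^ d) → suc n ·v x ≡ x +v (n ·v x)
·v-suc n []      = refl
·v-suc n (a ∷ x) = cong₂ _∷_ (ℤ.suc-* (+ n) a) (·v-suc n x)

‖_‖ : ∀ {d} → ℤ^ d → ℕ
‖ [] ‖    = 0
‖ a ∷ x ‖ = ℤ.∣ a ∣ ℕ.+ ‖ x ‖

‖0v‖≡0 : ∀ d → ‖ 0v {d} ‖ ≡ 0
‖0v‖≡0 ℕ.zero   = refl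
‖0v‖≡0 (suc d) = ‖0v‖≡0 d

x≢0v⇒‖x‖>0 : ∀ {d} (x : ℤ^ d) → x ≢ 0v → 0 < ‖ x ‖
x≢0v⇒‖x‖>0 []                 x≢0 = ⊥-elim (x≢0 refl)
x≢0v⇒‖x‖>0 (+ ℕ.zero ∷ x)     x≢0 = x≢0v⇒‖x‖>0 x (x≢0 ∘ cong (+ 0 ∷_))
x≢0v⇒‖x‖>0 (+ suc _ ∷ x)      _   = s≤s z≤n
x≢0v⇒‖x‖>0 (ℤ.-[1+ _ ] ∷ x)   _   = s≤s z≤n

‖n·vx‖≡n*‖x‖ : ∀ {d} n (x : ℤ^ d) → ‖ n ·v x ‖ ≡ n ℕ.* ‖ x ‖
‖n·vx‖≡n*‖x‖ n []      = sym (ℕ.*-zeroʳ n)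
‖n·vx‖≡n*‖x‖ n (a ∷ x) = begin
  ℤ.∣ + n ℤ.* a ∣ ℕ.+ ‖ n ·v x ‖   ≡⟨ cong₂ ℕ._+_ (ℤ.abs-* (+ n) a) (‖n·vx‖≡n*‖x‖ n x) ⟩
  n ℕ.* ℤ.∣ a ∣ ℕ.+ n ℕ.* ‖ x ‖    ≡⟨ sym (ℕ.*-distribˡ-+ n ℤ.∣ a ∣ ‖ x ‖) ⟩
  n ℕ.* (ℤ.∣ a ∣ ℕ.+ ‖ x ‖)        ∎

n≤‖n·vx‖ : ∀ {d} n (x : ℤ^ d) → x ≢ 0v → n ≤ ‖ n ·v x ‖
n≤‖n·vx‖ n x x≢0 = subst (n ≤_) (sym (‖n·vx‖≡n*‖x‖ n x))
  (subst (_≤ n ℕ.* ‖ x ‖) (ℕ.*-identityʳ n) (ℕ.*-monoʳ-≤ n (x≢0v⇒‖x‖>0 x x≢0)))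

·v-nonzero : ∀ {d} n (x : ℤ^ d) → x ≢ 0v → suc n ·v x ≢ 0v
·v-nonzero {d} n x x≢0 eq = ℕ.n≮0 (subst (suc n ≤_) ‖suc-n·vx‖≡0 (n≤‖n·vx‖ (suc n) x x≢0))
  where
  ‖suc-n·vx‖≡0 : ‖ suc n ·v x ‖ ≡ 0
  ‖suc-n·vx‖≡0 = trans (cong ‖_‖ eq) (‖0v‖≡0 d)

normSum : ∀ {d} → List (ℤ^ d) → ℕ
normSum G = sum (List.map ‖_‖ G)

∈⇒‖x‖≤normSum : ∀ {d} {x : ℤ^ d} (G : List (ℤ^ d)) → x ∈ G → ‖ x ‖ ≤ normSum G
∈⇒‖x‖≤normSum (g ∷ G) (here refl) = ℕ.m≤m+n ‖ g ‖ (normSum G)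
∈⇒‖x‖≤normSum (g ∷ G) (there x∈G) = ℕ.m≤n⇒m≤o+n ‖ g ‖ (∈⇒‖x‖≤normSum G x∈G)

large-multiple-∉ : ∀ {d} (G : List (ℤ^ d)) (x : ℤ^ d) → x ≢ 0v → suc (normSum G) ·v x ∉ G
large-multiple-∉ G x x≢0 kx∈G =
  ℕ.<⇒≱ (n≤‖n·vx‖ (suc (normSum G)) x x≢0) (∈⇒‖x‖≤normSum G kx∈G)

module ProperMultiplicationProperties {d : ℕ} (M : ProperMultiplication d) where
  open ProperMultiplication M

  ⊛-zeroˡ : ∀ s → 0v ⊛ s ≡ 0v
  ⊛-zeroˡ s = sym (+v-cancelʳ 0v (0v ⊛ s) (0v ⊛ s) (begin
    0v +v (0v ⊛ s)       ≡⟨ +v-identityˡ (0v ⊛ s) ⟩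
    0v ⊛ s               ≡⟨ cong (_⊛ s) (sym (+v-identityˡ 0v)) ⟩
    (0v +v 0v) ⊛ s       ≡⟨ distribʳ s 0v 0v ⟩
    (0v ⊛ s) +v (0v ⊛ s) ∎))

  ⊛-nonzero : ∀ {x y} → x ≢ 0v → y ≢ 0v → x ⊛ y ≢ 0v
  ⊛-nonzero {x} {y} x≢0 y≢0 xy≡0 with noZeroDivisors x y xy≡0
  ... | inj₁ x≡0 = x≢0 x≡0
  ... | inj₂ y≡0 = y≢0 y≡0

  ⊛-cancelʳ : ∀ {h} → h ≢ 0v → ∀ f f' → f ⊛ h ≡ f' ⊛ h → f ≡ f'
  ⊛-cancelʳ {h} h≢0 f f' eq with noZeroDivisors (f +v -v f') h δh≡0
    where
    δh≡0 : (f +v -v f') ⊛ h ≡ 0v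
    δh≡0 = +v-cancelʳ _ 0v (f' ⊛ h) (begin
      ((f +v -v f') ⊛ h) +v (f' ⊛ h) ≡⟨ sym (distribʳ h (f +v -v f') f') ⟩
      ((f +v -v f') +v f') ⊛ h       ≡⟨ cong (_⊛ h) (-v-+v-cancel f f') ⟩
      f ⊛ h                          ≡⟨ eq ⟩
      f' ⊛ h                         ≡⟨ sym (+v-identityˡ (f' ⊛ h)) ⟩
      0v +v (f' ⊛ h)                 ∎)
  ... | inj₁ δ≡0 = trans (sym (-v-+v-cancel f f')) (trans (cong (_+v f') δ≡0) (+v-identityˡ f'))
  ... | inj₂ h≡0 = ⊥-elim (h≢0 h≡0)

  ·v-⊛ : ∀ n x s → (n ·v x) ⊛ s ≡ n ·v (x ⊛ s)
  ·v-⊛ ℕ.zero x s = begin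
    (0 ·v x) ⊛ s   ≡⟨ cong (_⊛ s) (·v-zero x) ⟩
    0v ⊛ s         ≡⟨ ⊛-zeroˡ s ⟩
    0v             ≡⟨ sym (·v-zero (x ⊛ s)) ⟩
    0 ·v (x ⊛ s)   ∎
  ·v-⊛ (suc n) x s = begin
    (suc n ·v x) ⊛ s            ≡⟨ cong (_⊛ s) (·v-suc n x) ⟩
    (x +v (n ·v x)) ⊛ s         ≡⟨ distribʳ s x (n ·v x) ⟩
    (x ⊛ s) +v ((n ·v x) ⊛ s)   ≡⟨ cong ((x ⊛ s) +v_) (·v-⊛ n x s) ⟩
    (x ⊛ s) +v (n ·v (x ⊛ s))   ≡⟨ sym (·v-suc n (x ⊛ s)) ⟩
    suc n ·v (x ⊛ s)            ∎

  rightMultiple : FiniteNonzeroSet d → (h : ℤ^ d) → h ≢ 0v → FiniteNonzeroSet d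
  rightMultiple F h h≢0 = record
    { elems   = List.map (_⊛ h) (elems F)
    ; unique  = Unique.map⁺ (⊛-cancelʳ h≢0 _ _) (unique F)
    ; nonzero = All.map⁺ (All.map (λ f≢0 → ⊛-nonzero f≢0 h≢0) (nonzero F))
    }

  card-rightMultiple : ∀ F h (h≢0 : h ≢ 0v) → card (rightMultiple F h h≢0) ≡ card F
  card-rightMultiple F h _ = cong (λ n → + n ℚ./ 1) (List.length-map (_⊛ h) (elems F))

  countIn-rightMultiple : ∀ A F h (h≢0 : h ≢ 0v) s →
    countIn M A (rightMultiple F h h≢0) s ≡ countIn M A F (h ⊛ s)
  countIn-rightMultiple A F h _ s =
    cong (λ fs → + List.length (List.filterᵇ A (List.deduplicate _≟v_ fs)) ℚ./ 1) (begin
      List.map (_⊛ s) (List.map (_⊛ h) (elems F))  ≡⟨ List.map-∘ (elems F) ⟨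
      List.map ((_⊛ s) ∘ (_⊛ h)) (elems F)         ≡⟨ List.map-cong (λ f → assoc f h s) (elems F) ⟩
      List.map (_⊛ (h ⊛ s)) (elems F)              ∎)

SupEq-resp : ∀ {P Q : ℚ.ℚ → Set} → (∀ α → P α → Q α) → (∀ α → Q α → P α) → SupEq P Q
SupEq-resp P⇒Q Q⇒P q = (λ (α , 0≤α , q<α , Pα) → α , 0≤α , q<α , P⇒Q α Pα)
                     , (λ (α , 0≤α , q<α , Qα) → α , 0≤α , q<α , Q⇒P α Qα)

module _ {d : ℕ} (M : ProperMultiplication d) (A : Subset d) where
  open ProperMultiplication M
  open ProperMultiplicationProperties M

  DensityProp⇒InfDensityProp : ∀ α → DensityProp M A α → InfDensityProp M A α
  DensityProp⇒InfDensityProp α D F G with D F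
  ... | x , x≢0 , _ = escape (D F')
    where
    h : ℤ^ d
    h = suc (normSum G) ·v x

    h≢0 : h ≢ 0v
    h≢0 = ·v-nonzero (normSum G) x x≢0

    F' : FiniteNonzeroSet d
    F' = rightMultiple F h h≢0

    escape : Σ (ℤ^ d) (λ s → s ≢ 0v × (α ℚ.* card F' ℚ.≤ countIn M A F' s)) →
             Σ (ℤ^ d) (λ z → z ≢ 0v × z ∉ G × (α ℚ.* card F ℚ.≤ countIn M A F z))
    escape (s , s≢0 , large) =
        h ⊛ s
      , ⊛-nonzero h≢0 s≢0
      , subst (_∉ G) (sym (·v-⊛ (suc (normSum G)) x s)) (large-multiple-∉ G (x ⊛ s) (⊛-nonzero x≢0 s≢0))
      , subst₂ (λ c n → α ℚ.* c ℚ.≤ n) (card-rightMultiple F h h≢0) (countIn-rightMultiple A F h h≢0 s) large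

  InfDensityProp⇒DensityProp : ∀ α → InfDensityProp M A α → DensityProp M A α
  InfDensityProp⇒DensityProp α I F with I F []
  ... | z , z≢0 , _ , large = z , z≢0 , large

  SmallOnCofinite⇒DensityZero : SmallOnCofinite M A → DensityZero M A
  SmallOnCofinite⇒DensityZero small α α>0 D =
    let F , G , smallOutsideG = small α α>0
        z , z≢0 , z∉G , large = DensityProp⇒InfDensityProp α D F G
    in ℚ.<-irrefl refl (ℚ.<-≤-trans (smallOutsideG z z≢0 z∉G) large)

  DensityZero⇒SmallOnCofinite : ExcludedMiddle 0ℓ → DensityZero M A → SmallOnCofinite M A
  DensityZero⇒SmallOnCofinite em zeroDensity ε ε>0 = dne λ notSmall →
    zeroDensity ε ε>0 (InfDensityProp⇒DensityProp ε λ F G → dne λ noLargeOutsideG →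
      notSmall (F , G , λ z z≢0 z∉G → ℚ.≰⇒> λ large → noLargeOutsideG (z , z≢0 , z∉G , large)))
    where
    dne : DoubleNegationElimination 0ℓ
    dne = em⇒dne em

lemma5p8 : ExcludedMiddle 0ℓ → {d : ℕ} → (M : ProperMultiplication d) → (A : Subset d) →
    (∀ x → A x ≡ true → x ≢ 0v) →
    SupEq (DensityProp M A) (InfDensityProp M A) × (DensityZero M A ⇔ SmallOnCofinite M A)
lemma5p8 em M A _ =
    SupEq-resp (DensityProp⇒InfDensityProp M A) (InfDensityProp⇒DensityProp M A)
  , mk⇔ (DensityZero⇒SmallOnCofinite M A em) (SmallOnCofinite⇒DensityZero M A)
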